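{- Let $\phi$ be a formula and $x\in\mathrm{FV}(\phi)$. If $x$ occurs both positively and negatively in $\phi$, then neither $\mathit{posin}(x,\phi)$ nor $\mathit{negin}(x,\phi)$ is derivable.
   Context: Formulae of the modal $\mu$-calculus: $\phi::=p\mid \mathit{ff}\mid\neg\phi\mid\phi\supset\psi\mid[a]\phi\mid x\mid\mu x\phi$. An occurrence of $x$ is positive if it lies under an even number of negations and negative if under an odd number (the antecedent of an implication counting as one negation); $x$ occurs both positively and negatively if it has at least one free positive and at least one free negative occurrence. Judgements $\mathit{posin}(x,\phi)$, $\mathit{negin}(x,\phi)$ are derived by: $\mathit{posin}(x,p)$ and $\mathit{negin}(x,p)$ for atoms $p$; $\mathit{posin}(x,y)$ for every variable $y$; $\mathit{negin}(x,y)$ for $y\ne x$; $\mathit{posin}(x,\phi\supset\psi)$ from $\mathit{negin}(x,\phi)$ and $\mathit{posin}(x,\psi)$; $\mathit{negin}(x,\phi\supset\psi)$ from $\mathit{posin}(x,\phi)$ and $\mathit{negin}(x,\psi)$; $\mathit{posin}(x,\neg\phi)$ from $\mathit{negin}(x,\phi)$; $\mathit{negin}(x,\neg\phi)$ from $\mathit{posin}(x,\phi)$; $\mathit{posin}(x,[a]\phi)$ from $\mathit{posin}(x,\phi)$; $\mathit{negin}(x,[a]\phi)$ from $\mathit{negin}(x,\phi)$; $\mathit{posin}(x,\mu y\phi)$ from $\mathit{posin}(x,\phi[z/y])$ for all $z\ne x$; $\mathit{negin}(x,\mu y\phi)$ from $\mathit{negin}(x,\phi[z/y])$ for all $z\ne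 x$. -}

module Defs where

open import Data.Nat using (ℕ; zero; suc; _⊔_; _+_)
open import Data.Bool using (Bool; true; false; not)
open import Relation.Nullary using (¬_; yes; no)
open import Relation.Binary.PropositionalEquality using (_≡_; _≢_)
open import Data.Product using (_×_; ∃)
open import Data.Nat using (_≟_)

Var : Set
Var = ℕ

Atom : Set
Atom = ℕ

Act : Set
Act = ℕ

infixr 5 _⊃_
data Form : Set where
  prop : Atom → Form
  ff   : Form
  ¬'_  : Form → Form
  _⊃_  : Form → Form → Form
  box  : Act → Form → Form
  var  : Var → Form
  μ    : Var → Form → Form

maxVar : Form → ℕ
maxVar (prop p) = 0
maxVar ff = 0
maxVar (¬' φ) = maxVar φ
maxVar (φ ⊃ ψ) = maxVar φ ⊔ maxVar ψ
maxVar (box a φ) = maxVar φ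
maxVar (var y) = y
maxVar (μ y φ) = y ⊔ maxVar φ

-- Renaming of a bound variable: replace every occurrence (free w.r.t. the
-- binder) of u by v, where v is assumed fresh (so no capture can occur).
-- Size-preserving, so it is used inside substitution.
rename : Var → Var → Form → Form
rename u v (prop p) = prop p
rename u v ff = ff
rename u v (¬' φ) = ¬' rename u v φ
rename u v (φ ⊃ ψ) = rename u v φ ⊃ rename u v ψ
rename u v (box a φ) = box a (rename u v φ)
rename u v (var w) with w ≟ u
... | yes _ = var v
... | no _ = var w
rename u v (μ w φ) with w ≟ u
... | yes _ = μ w φ
... | no _ = μ w (rename u v φ)

size : Form → ℕ
size (prop p) = 1
size ff = 1
size (¬' φ) = suc (size φ)
size (φ ⊃ ψ) = suc (size φ + size ψ)
size (box a φ) = suc (size φ)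
size (var y) = 1
size (μ y φ) = suc (size φ)

-- Defined with fuel (the size of the formula) to make termination structural.
substF : ℕ → Form → Var → Var → Form
substF zero φ z y = φ
substF (suc n) (prop p) z y = prop p
substF (suc n) ff z y = ff
substF (suc n) (¬' φ) z y = ¬' substF n φ z y
substF (suc n) (φ ⊃ ψ) z y = substF n φ z y ⊃ substF n ψ z y
substF (suc n) (box a φ) z y = box a (substF n φ z y)
substF (suc n) (var w) z y with w ≟ y
... | yes _ = var z
... | no _ = var w
substF (suc n) (μ w φ) z y with w ≟ y
... | yes _ = μ w φ
... | no _ with w ≟ z
...   | no _ = μ w (substF n φ z y)
...   | yes _ = let w' = suc (maxVar φ ⊔ z ⊔ y ⊔ w)
                in μ w' (substF n (rename w w' φ) z y)

_[_/_] : Form → Var → Var → Form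
φ [ z / y ] = substF (size φ) φ z y

mutual
  data posin (x : Var) : Form → Set where
    pos-prop : ∀ p → posin x (prop p)
    pos-var  : ∀ y → posin x (var y)
    pos-imp  : ∀ {φ ψ} → negin x φ → posin x ψ → posin x (φ ⊃ ψ)
    pos-neg  : ∀ {φ} → negin x φ → posin x (¬' φ)
    pos-box  : ∀ {a φ} → posin x φ → posin x (box a φ)
    pos-mu   : ∀ {y φ} → (∀ z → z ≢ x → posin x (φ [ z / y ])) → posin x (μ y φ)

  data negin (x : Var) : Form → Set where
    neg-prop : ∀ p → negin x (prop p)
    neg-var  : ∀ y → y ≢ x → negin x (var y)
    neg-imp  : ∀ {φ ψ} → posin x φ → negin x ψ → negin x (φ ⊃ ψ)
    neg-neg  : ∀ {φ} → posin x φ → negin x (¬' φ)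
    neg-box  : ∀ {a φ} → negin x φ → negin x (box a φ)
    neg-mu   : ∀ {y φ} → (∀ z → z ≢ x → negin x (φ [ z / y ])) → negin x (μ y φ)

data _∈FV_ (x : Var) : Form → Set where
  fv-var  : x ∈FV var x
  fv-neg  : ∀ {φ} → x ∈FV φ → x ∈FV (¬' φ)
  fv-impl : ∀ {φ ψ} → x ∈FV φ → x ∈FV (φ ⊃ ψ)
  fv-impr : ∀ {φ ψ} → x ∈FV ψ → x ∈FV (φ ⊃ ψ)
  fv-box  : ∀ {a φ} → x ∈FV φ → x ∈FV (box a φ)
  fv-mu   : ∀ {y φ} → y ≢ x → x ∈FV φ → x ∈FV (μ y φ)

-- OccursWith b x φ: x has a free occurrence in φ lying under an even (b = true)
-- resp. odd (b = false) number of negations, where the antecedent of an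
-- implication counts as one negation.
data OccursWith (x : Var) : Bool → Form → Set where
  occ-var  : OccursWith x true (var x)
  occ-neg  : ∀ {b φ} → OccursWith x (not b) φ → OccursWith x b (¬' φ)
  occ-impl : ∀ {b φ ψ} → OccursWith x (not b) φ → OccursWith x b (φ ⊃ ψ)
  occ-impr : ∀ {b φ ψ} → OccursWith x b ψ → OccursWith x b (φ ⊃ ψ)
  occ-box  : ∀ {b a φ} → OccursWith x b φ → OccursWith x b (box a φ)
  occ-mu   : ∀ {b y φ} → y ≢ x → OccursWith x b φ → OccursWith x b (μ y φ)

OccursPositively : Var → Form → Set
OccursPositively x φ = OccursWith x true φ

OccursNegatively : Var → Form → Set
OccursNegatively x φ = OccursWith x false φ

-- Following a positive occurrence of x down through a derivation of negin x φ
-- (the rules are syntax-directed, and each connective flips polarity exactly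
-- as it flips posin/negin) ends at negin x (var x), which has no derivation;
-- dually for negative occurrences and posin.  A binder μ y with y ≢ x is
-- passed by instantiating its premise at z = y, where φ [ y / y ] is φ itself.
{-# OPTIONS --safe #-}
module Submission where

open import Defs
open import Data.Product using (_×_; _,_)
open import Relation.Nullary using (¬_; yes; no)
open import Data.Nat using (zero; suc; _≟_)
open import Data.Empty using (⊥-elim)
open import Relation.Binary.PropositionalEquality using (_≡_; refl; cong; cong₂; subst)

substF-self : ∀ n φ y → substF n φ y y ≡ φ
substF-self zero    φ         y = refl
substF-self (suc n) (prop p)  y = refl
substF-self (suc n) ff        y = refl
substF-self (suc n) (¬' φ)    y = cong ¬'_ (substF-self n φ y)
substF-self (suc n) (φ ⊃ ψ)   y = cong₂ _⊃_ (substF-self n φ y) (substF-self n ψ y)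
substF-self (suc n) (box a φ) y = cong (box a) (substF-self n φ y)
substF-self (suc n) (var w)   y with w ≟ y
... | yes refl = refl
... | no _     = refl
substF-self (suc n) (μ w φ)   y with w ≟ y
... | yes _ = refl
... | no w≢y with w ≟ y
...   | yes w≡y = ⊥-elim (w≢y w≡y)
...   | no _    = cong (μ w) (substF-self n φ y)

[/]-self : ∀ φ y → φ [ y / y ] ≡ φ
[/]-self φ = substF-self (size φ) φ

mutual
  occursPositively⇒¬negin : ∀ {x φ} → OccursPositively x φ → ¬ negin x φ
  occursPositively⇒¬negin occ-var      (neg-var _ x≢x) = x≢x refl
  occursPositively⇒¬negin (occ-neg o)  (neg-neg p)     = occursNegatively⇒¬posin o p
  occursPositively⇒¬negin (occ-impl o) (neg-imp p _)   = occursNegatively⇒¬posin o p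
  occursPositively⇒¬negin (occ-impr o) (neg-imp _ n)   = occursPositively⇒¬negin o n
  occursPositively⇒¬negin (occ-box o)  (neg-box n)     = occursPositively⇒¬negin o n
  occursPositively⇒¬negin {x} {μ y φ} (occ-mu y≢x o) (neg-mu n) =
    occursPositively⇒¬negin o (subst (negin x) ([/]-self φ y) (n y y≢x))

  occursNegatively⇒¬posin : ∀ {x φ} → OccursNegatively x φ → ¬ posin x φ
  occursNegatively⇒¬posin (occ-neg o)  (pos-neg n)     = occursPositively⇒¬negin o n
  occursNegatively⇒¬posin (occ-impl o) (pos-imp n _)   = occursPositively⇒¬negin o n
  occursNegatively⇒¬posin (occ-impr o) (pos-imp _ p)   = occursNegatively⇒¬posin o p
  occursNegatively⇒¬posin (occ-box o)  (pos-box p)     = occursNegatively⇒¬posin o p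
  occursNegatively⇒¬posin {x} {μ y φ} (occ-mu y≢x o) (pos-mu p) =
    occursNegatively⇒¬posin o (subst (posin x) ([/]-self φ y) (p y y≢x))

-- The hypothesis x ∈FV φ is implied by either occurrence hypothesis.
proposition3 : (φ : Form) (x : Var) → x ∈FV φ →
    OccursPositively x φ → OccursNegatively x φ →
    ¬ posin x φ × ¬ negin x φ
proposition3 φ x _ positive negative =
  occursNegatively⇒¬posin negative , occursPositively⇒¬negin positive
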